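{- Let $G$ be a finite connected graph with chromatic number $\chi$, and let $c$ be a nice $\chi$-coloring of $G$. Then the height $h(c)$ satisfies $h(c)\ge 2\chi-1$.
   Context: A proper $\chi$-coloring of $G$ is a map $c:V(G)\to\{1,\dots,\chi\}$ with $c(u)\ne c(v)$ for adjacent $u,v$; colors are considered modulo $\chi$. For such $c$, $D_c$ is the oriented graph on $V(G)$ in which $ab$ is an arc iff $\{a,b\}\in E(G)$ and $c(b)\equiv c(a)+1\pmod{\chi}$. The coloring $c$ is nice if $D_c$ is acyclic with exactly one sink. For an acyclic oriented graph $D$, its level partition $(V_1,\dots,V_k)$ is defined by letting $V_i$ be the set of sinks of the oriented subgraph of $D$ induced on $V(D)\setminus(V_1\cup\dots\cup V_{i-1})$, until all vertices are used; $k$ is the height of the partition. For acyclic $D_c$, the height $h(c)$ of $c$ is the height of the level partition of $D_c$ (equivalently, the number of vertices of a longest oriented path in $D_c$). -}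

module Defs where

open import Data.Nat using (ℕ; zero; suc; _≤_; _+_)
open import Data.Fin using (Fin; toℕ)
open import Data.List using (List; []; _∷_; _++_; [_]; length)
open import Data.List.Relation.Unary.Linked using (Linked)
open import Data.List.Relation.Unary.Unique.Propositional using (Unique)
open import Data.Product using (Σ; ∃; _×_; _,_)
open import Data.Sum using (_⊎_)
open import Data.Empty using (⊥)
open import Relation.Nullary using (¬_)
open import Relation.Binary.PropositionalEquality using (_≡_; _≢_)
open import Relation.Binary.Construct.Closure.ReflexiveTransitive using (Star)

record Graph : Set₁ where
  field
    n      : ℕ
    Adj    : Fin n → Fin n → Set
    sym    : ∀ {u v} → Adj u v → Adj v u
    irrefl : ∀ {u} → ¬ Adj u u

open Graph public

Connected : Graph → Set
Connected G = (1 ≤ n G) × (∀ u v → Star (Adj G) u v)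

-- A k-coloring (colors are Fin k, i.e. {1..k} shifted to {0..k-1}).
Coloring : Graph → ℕ → Set
Coloring G k = Fin (n G) → Fin k

Proper : (G : Graph) (k : ℕ) → Coloring G k → Set
Proper G k c = ∀ {u v} → Adj G u v → c u ≢ c v

ChromaticNumber : Graph → ℕ → Set
ChromaticNumber G χ =
  (Σ (Coloring G χ) (Proper G χ)) × (∀ k (c : Coloring G k) → Proper G k c → χ ≤ k)

SuccMod : (k : ℕ) → Fin k → Fin k → Set
SuccMod k a b = (toℕ b ≡ suc (toℕ a)) ⊎ ((suc (toℕ a) ≡ k) × (toℕ b ≡ 0))

Arc : (G : Graph) (k : ℕ) → Coloring G k → Fin (n G) → Fin (n G) → Set
Arc G k c a b = Adj G a b × SuccMod k (c a) (c b)

module _ {m : ℕ} (A : Fin m → Fin m → Set) where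

  Acyclic : Set
  Acyclic = ∀ x (xs : List (Fin m)) → ¬ Linked A (x ∷ xs ++ [ x ])

  Sink : Fin m → Set
  Sink v = ∀ w → ¬ A v w

  ExactlyOneSink : Set
  ExactlyOneSink = Σ (Fin m) λ v → Sink v × (∀ w → Sink w → w ≡ v)

  DirPath : List (Fin m) → Set
  DirPath ps = Unique ps × Linked A ps

  IsHeight : ℕ → Set
  IsHeight h = (Σ (List (Fin m)) λ ps → DirPath ps × length ps ≡ h)
             × (∀ ps → DirPath ps → length ps ≤ h)

Nice : (G : Graph) (k : ℕ) → Coloring G k → Set
Nice G k c = Proper G k c × Acyclic (Arc G k c) × ExactlyOneSink (Arc G k c)

-- Let s be the unique sink of D_c and a := c(s) + 1. Recolour every vertex that has an
-- oriented walk to a vertex of colour a by c − 1, keeping the others. This is again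
-- proper: an edge whose endpoints collide is an arc into the recoloured class, so its
-- tail is recoloured too. Colours increase by one along arcs, so a recoloured vertex v
-- with c(v) − 1 = a needs a walk of length ≥ χ − 1 to reach colour a, and from there a
-- walk of length ≥ χ − 1 to the sink s (which every vertex reaches, as s is the only
-- sink). In an acyclic D_c such a walk is a path on ≥ 2χ − 1 vertices. Hence if
-- h(c) < 2χ − 1, the new colouring never uses a, contradicting minimality of χ.
module Submission where

open import Defs hiding (sym)
open import Data.Nat using (ℕ; zero; suc; s≤s; _≤_; _<_; _+_; _*_; _∸_; _%_; _/_; _≤?_)
open import Data.Nat.Properties
open import Data.Nat.DivMod using (m%n<n; m<n⇒m%n≡m; %-distribˡ-+; m%n%n≡m%n; [m+n]%n≡m%n; n%n≡0; m≡m%n+[m/n]*n)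
open import Data.Fin using (Fin; toℕ; fromℕ<; punchOut)
open import Data.Fin.Properties using (toℕ<n; toℕ-fromℕ<; toℕ-injective; punchOut-injective; sequence)
open import Data.List using (List; []; _∷_; _++_; [_]; length)
open import Data.List.Relation.Unary.Linked using (Linked; []; [-]; _∷_)
open import Data.List.Relation.Unary.AllPairs using ([]; _∷_)
open import Data.List.Relation.Unary.All as All using ()
open import Data.List.Relation.Unary.Any using (here; there)
open import Data.List.Membership.Propositional using (_∈_)
open import Data.List.Relation.Unary.Unique.Propositional using (Unique)
open import Data.Product using (Σ; ∃-syntax; _×_; _,_)
open import Data.Sum using (inj₁; inj₂)
open import Effect.Monad using (RawMonad)
open import Relation.Nullary using (¬_; Dec; yes; no; contradiction)
open import Relation.Nullary.Decidable using (decidable-stable; ¬¬-excluded-middle)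
open import Relation.Nullary.Negation using (¬¬-Monad)
open import Relation.Binary.PropositionalEquality hiding ([_])
open ≡-Reasoning

module _ {m : ℕ} where

  infixl 6 _⊕_
  _⊕_ : Fin (suc m) → ℕ → Fin (suc m)
  a ⊕ k = fromℕ< (m%n<n (toℕ a + k) (suc m))

  toℕ-⊕ : ∀ a k → toℕ (a ⊕ k) ≡ (toℕ a + k) % suc m
  toℕ-⊕ a k = toℕ-fromℕ< (m%n<n (toℕ a + k) (suc m))

  ⊕-identityʳ : ∀ a → a ⊕ 0 ≡ a
  ⊕-identityʳ a = toℕ-injective (begin
    toℕ (a ⊕ 0)          ≡⟨ toℕ-⊕ a 0 ⟩
    (toℕ a + 0) % suc m  ≡⟨ cong (_% suc m) (+-identityʳ (toℕ a)) ⟩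
    toℕ a % suc m        ≡⟨ m<n⇒m%n≡m (toℕ<n a) ⟩
    toℕ a                ∎)

  ⊕-assoc : ∀ a j k → a ⊕ j ⊕ k ≡ a ⊕ (j + k)
  ⊕-assoc a j k = toℕ-injective (begin
    toℕ (a ⊕ j ⊕ k)                    ≡⟨ toℕ-⊕ (a ⊕ j) k ⟩
    (toℕ (a ⊕ j) + k) % N              ≡⟨ cong (λ t → (t + k) % N) (toℕ-⊕ a j) ⟩
    ((toℕ a + j) % N + k) % N          ≡⟨ %-distribˡ-+ ((toℕ a + j) % N) k N ⟩
    ((toℕ a + j) % N % N + k % N) % N  ≡⟨ cong (λ t → (t + k % N) % N) (m%n%n≡m%n (toℕ a + j) N) ⟩
    ((toℕ a + j) % N + k % N) % N      ≡⟨ %-distribˡ-+ (toℕ a + j) k N ⟨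
    (toℕ a + j + k) % N                ≡⟨ cong (_% N) (+-assoc (toℕ a) j k) ⟩
    (toℕ a + (j + k)) % N              ≡⟨ toℕ-⊕ a (j + k) ⟨
    toℕ (a ⊕ (j + k))                  ∎)
    where N = suc m

  ⊕-period : ∀ a → a ⊕ suc m ≡ a
  ⊕-period a = toℕ-injective (begin
    toℕ (a ⊕ suc m)          ≡⟨ toℕ-⊕ a (suc m) ⟩
    (toℕ a + suc m) % suc m  ≡⟨ [m+n]%n≡m%n (toℕ a) (suc m) ⟩
    toℕ a % suc m            ≡⟨ m<n⇒m%n≡m (toℕ<n a) ⟩
    toℕ a                    ∎)

  ⊕-inverseˡ : ∀ a → a ⊕ m ⊕ 1 ≡ a
  ⊕-inverseˡ a = trans (⊕-assoc a m 1) (trans (cong (a ⊕_) (+-comm m 1)) (⊕-period a))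

  ⊕-inverseʳ : ∀ a → a ⊕ 1 ⊕ m ≡ a
  ⊕-inverseʳ a = trans (⊕-assoc a 1 m) (⊕-period a)

  ⊕-fixed⇒≡0 : ∀ a d → a ⊕ d ≡ a → d < suc m → d ≡ 0
  ⊕-fixed⇒≡0 a d fixed d<N = multiple<⇒≡0 ((toℕ a + d) / N) (+-cancelˡ-≡ (toℕ a) d _ a+d≡a+qN)
    where
    N = suc m
    a+d≡a+qN : toℕ a + d ≡ toℕ a + (toℕ a + d) / N * N
    a+d≡a+qN = begin
      toℕ a + d                               ≡⟨ m≡m%n+[m/n]*n (toℕ a + d) N ⟩
      (toℕ a + d) % N + (toℕ a + d) / N * N   ≡⟨ cong (_+ (toℕ a + d) / N * N) (toℕ-⊕ a d) ⟨
      toℕ (a ⊕ d) + (toℕ a + d) / N * N       ≡⟨ cong (λ r → toℕ r + (toℕ a + d) / N * N) fixed ⟩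
      toℕ a + (toℕ a + d) / N * N             ∎
    multiple<⇒≡0 : ∀ q → d ≡ q * N → d ≡ 0
    multiple<⇒≡0 zero    d≡0 = d≡0
    multiple<⇒≡0 (suc q) d≡qN = contradiction (subst (N ≤_) (sym d≡qN) (m≤m+n N (q * N))) (<⇒≱ d<N)

  ⊕-cancel-≤ : ∀ a {j k} → a ⊕ j ≡ a ⊕ k → j < suc m → j ≤ k
  ⊕-cancel-≤ a {j} {k} eq j<N = ≮⇒≥ λ k<j →
    <⇒≢ (m<n⇒0<n∸m k<j) (sym (⊕-fixed⇒≡0 (a ⊕ k) (j ∸ k) (shift k<j) (≤-<-trans (m∸n≤m j k) j<N)))
    where
    shift : k < j → a ⊕ k ⊕ (j ∸ k) ≡ a ⊕ k
    shift k<j = trans (⊕-assoc a k (j ∸ k)) (trans (cong (a ⊕_) (m+[n∸m]≡n (<⇒≤ k<j))) eq)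

  toℕ-⊕1 : ∀ a → toℕ (a ⊕ 1) ≡ suc (toℕ a) % suc m
  toℕ-⊕1 a = trans (toℕ-⊕ a 1) (cong (_% suc m) (+-comm (toℕ a) 1))

  SuccMod⇒≡⊕1 : ∀ {a b} → SuccMod (suc m) a b → b ≡ a ⊕ 1
  SuccMod⇒≡⊕1 {a} {b} (inj₁ b≡1+a) = toℕ-injective (begin
    toℕ b                ≡⟨ m<n⇒m%n≡m (toℕ<n b) ⟨
    toℕ b % suc m        ≡⟨ cong (_% suc m) b≡1+a ⟩
    suc (toℕ a) % suc m  ≡⟨ toℕ-⊕1 a ⟨
    toℕ (a ⊕ 1)          ∎)
  SuccMod⇒≡⊕1 {a} {b} (inj₂ (1+a≡N , b≡0)) = toℕ-injective (begin
    toℕ b                ≡⟨ b≡0 ⟩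
    0                    ≡⟨ n%n≡0 (suc m) ⟨
    suc m % suc m        ≡⟨ cong (_% suc m) 1+a≡N ⟨
    suc (toℕ a) % suc m  ≡⟨ toℕ-⊕1 a ⟨
    toℕ (a ⊕ 1)          ∎)

  SuccMod-⊕1 : ∀ a → SuccMod (suc m) a (a ⊕ 1)
  SuccMod-⊕1 a with m≤n⇒m<n∨m≡n (toℕ<n a)
  ... | inj₁ 1+a<N = inj₁ (trans (toℕ-⊕1 a) (m<n⇒m%n≡m 1+a<N))
  ... | inj₂ 1+a≡N = inj₂ (1+a≡N , trans (toℕ-⊕1 a) (trans (cong (_% suc m) 1+a≡N) (n%n≡0 (suc m))))

module _ {M : ℕ} (A : Fin M → Fin M → Set) where

  infixr 5 _◅_

  data Walk : Fin M → Fin M → ℕ → Set where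
    ε   : ∀ {x} → Walk x x 0
    _◅_ : ∀ {x y z k} → A x y → Walk y z k → Walk x z (suc k)

module _ {M : ℕ} {A : Fin M → Fin M → Set} where

  infixr 5 _◅◅_

  _◅◅_ : ∀ {x y z j k} → Walk A x y j → Walk A y z k → Walk A x z (j + k)
  ε ◅◅ w′ = w′
  (e ◅ w) ◅◅ w′ = e ◅ (w ◅◅ w′)

  _▻_ : ∀ {x y z k} → Walk A x y k → A y z → Walk A x z (suc k)
  ε ▻ e′ = e′ ◅ ε
  (e ◅ w) ▻ e′ = e ◅ (w ▻ e′)

  vertices : ∀ {x y k} → Walk A x y k → List (Fin M)
  vertices {x} ε = [ x ]
  vertices {x} (e ◅ w) = x ∷ vertices w

  length-vertices : ∀ {x y k} (w : Walk A x y k) → length (vertices w) ≡ suc k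
  length-vertices ε = refl
  length-vertices (e ◅ w) = cong suc (length-vertices w)

  vertices-linked : ∀ {x y k} (w : Walk A x y k) → Linked A (vertices w)
  vertices-linked ε = [-]
  vertices-linked (e ◅ ε) = e ∷ [-]
  vertices-linked (e ◅ w@(_ ◅ _)) = e ∷ vertices-linked w

module _ {M : ℕ} (A : Fin M → Fin M → Set) where

  linked-segment : ∀ {x y zs} → Linked A (y ∷ zs) → x ∈ zs →
                   Σ (List (Fin M)) λ ys → Linked A (y ∷ ys ++ [ x ])
  linked-segment (e ∷ _) (here refl) = [] , e ∷ [-]
  linked-segment (e ∷ l) (there x∈zs) with linked-segment l x∈zs
  ... | ys , l′ = _ ∷ ys , e ∷ l′

  acyclic⇒linked⇒unique : Acyclic A → ∀ {xs} → Linked A xs → Unique xs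
  acyclic⇒linked⇒unique acyclic [] = []
  acyclic⇒linked⇒unique acyclic [-] = All.[] ∷ []
  acyclic⇒linked⇒unique acyclic {x ∷ xs} l@(_ ∷ l′) =
    All.tabulate (λ z∈xs x≡z → let ys , cycle = linked-segment l (subst (_∈ xs) (sym x≡z) z∈xs)
                               in acyclic x ys cycle)
    ∷ acyclic⇒linked⇒unique acyclic l′

  walk-length< : Acyclic A → ∀ {h} → (∀ ps → DirPath A ps → length ps ≤ h) →
                 ∀ {x y k} → Walk A x y k → k < h
  walk-length< acyclic longest w = subst (_≤ _) (length-vertices w) (longest (vertices w) path)
    where
    path = acyclic⇒linked⇒unique acyclic (vertices-linked w) , vertices-linked w

  ReachesSink : Fin M → Set
  ReachesSink v = ∃[ s ] Sink A s × ∃[ k ] Walk A v s k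

  module _ {h : ℕ} (bounded : ∀ {x y k} → Walk A x y k → k < h) where

    -- Keep following outgoing arcs: a walk cannot reach length h, so a sink is met within h steps.
    reachesSink-after : ∀ f {u v k} → Walk A u v k → h ≤ k + f → ¬ ¬ ReachesSink v
    reachesSink-after zero {k = k} w h≤k _ = <⇒≱ (bounded w) (subst (h ≤_) (+-identityʳ k) h≤k)
    reachesSink-after (suc f) {v = v} {k} w h≤ ¬reaches = ¬¬-excluded-middle λ where
      (yes sink) → ¬reaches (v , sink , 0 , ε)
      (no ¬sink) → ¬sink λ z e → reachesSink-after f (w ▻ e) (subst (h ≤_) (+-suc k f) h≤)
                                   λ (s , sink , j , w′) → ¬reaches (s , sink , suc j , e ◅ w′)

    ¬¬-reachesSink : ∀ v → ¬ ¬ ReachesSink v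
    ¬¬-reachesSink v = reachesSink-after h (ε {x = v}) ≤-refl

omitColour : (G : Graph) {m : ℕ} (c : Coloring G (suc m)) (a : Fin (suc m)) →
             Proper G (suc m) c → (∀ v → c v ≢ a) → Σ (Coloring G m) (Proper G m)
omitColour G c a proper avoids =
  (λ v → punchOut (a≢ v)) , λ adj eq → proper adj (punchOut-injective (a≢ _) (a≢ _) eq)
  where
  a≢ = λ v → ≢-sym (avoids v)

module _ (G : Graph) {m : ℕ} (c : Coloring G (suc m)) where

  private
    D = Arc G (suc m) c

  colour-walk : ∀ {u v k} → Walk D u v k → c v ≡ c u ⊕ k
  colour-walk {u} ε = sym (⊕-identityʳ (c u))
  colour-walk {u} {v} {suc k} (_◅_ {y = y} (_ , succ) w) = begin
    c v          ≡⟨ colour-walk w ⟩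
    c y ⊕ k      ≡⟨ cong (_⊕ k) (SuccMod⇒≡⊕1 succ) ⟩
    c u ⊕ 1 ⊕ k  ≡⟨ ⊕-assoc (c u) 1 k ⟩
    c u ⊕ suc k  ∎

  ReachesColour : Fin (suc m) → Fin (n G) → Set
  ReachesColour a v = ∃[ x ] c x ≡ a × ∃[ k ] Walk D v x k

  module Recolour (proper : Proper G (suc m) c) (a : Fin (suc m)) where

    recolour : ∀ {v} → Dec (ReachesColour a v) → Fin (suc m)
    recolour {v} (yes _) = c v ⊕ m
    recolour {v} (no _)  = c v

    reachesColour-backwards : ∀ {u v} → Adj G u v → c u ≡ c v ⊕ m → ReachesColour a v → ReachesColour a u
    reachesColour-backwards {u} {v} adj cu≡ (x , cx≡a , k , w) = x , cx≡a , suc k , (adj , succ) ◅ w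
      where
      succ : SuccMod (suc m) (c u) (c v)
      succ = subst (SuccMod (suc m) (c u)) (trans (cong (_⊕ 1) cu≡) (⊕-inverseˡ (c v))) (SuccMod-⊕1 (c u))

    recolour-proper : ∀ {u v} (du : Dec (ReachesColour a u)) (dv : Dec (ReachesColour a v)) →
                      Adj G u v → recolour du ≢ recolour dv
    recolour-proper {u} {v} (yes _) (yes _) adj eq = proper adj (begin
      c u          ≡⟨ ⊕-inverseˡ (c u) ⟨
      c u ⊕ m ⊕ 1  ≡⟨ cong (_⊕ 1) eq ⟩
      c v ⊕ m ⊕ 1  ≡⟨ ⊕-inverseˡ (c v) ⟩
      c v          ∎)
    recolour-proper (no _)    (no _)    adj eq = proper adj eq
    recolour-proper (no ¬ru)  (yes rv)  adj eq = ¬ru (reachesColour-backwards adj eq rv)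
    recolour-proper (yes ru)  (no ¬rv)  adj eq = ¬rv (reachesColour-backwards (Graph.sym G adj) (sym eq) ru)

    recolour-avoids : (∀ v → ReachesColour a v → c v ⊕ m ≢ a) →
                      ∀ {v} (dv : Dec (ReachesColour a v)) → recolour dv ≢ a
    recolour-avoids _              {v} (no ¬rv) cv≡a = ¬rv (v , cv≡a , 0 , ε)
    recolour-avoids shifted-avoids {v} (yes rv)      = shifted-avoids v rv

  module _ (acyclic : Acyclic D) {s} (unique : ∀ w → Sink D w → w ≡ s)
           {h} (longest : ∀ ps → DirPath D ps → length ps ≤ h) where

    ¬¬-walkToSink : ∀ v → ¬ ¬ (∃[ k ] Walk D v s k)
    ¬¬-walkToSink v ¬walk = ¬¬-reachesSink D (walk-length< D acyclic longest) v
      λ (s′ , sink , k , w) → ¬walk (k , subst (λ t → Walk D v t k) (unique s′ sink) w)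

    shifted-onto-successor⇒long : ∀ v → ReachesColour (c s ⊕ 1) v → c v ⊕ m ≡ c s ⊕ 1 →
                                  ¬ ¬ (m + suc m ≤ h)
    shifted-onto-successor⇒long v (x , cx≡a , k₁ , w₁) cv-1≡a ¬long =
      ¬¬-walkToSink x λ (_ , w₂) → ¬long (long w₂)
      where
      m≤k₁ : m ≤ k₁
      m≤k₁ = ⊕-cancel-≤ (c v) (trans cv-1≡a (trans (sym cx≡a) (colour-walk w₁))) (n<1+n m)
      long : ∀ {k₂} → Walk D x s k₂ → m + suc m ≤ h
      long {k₂} w₂ = ≤-trans (≤-reflexive (+-suc m m))
                       (≤-trans (s≤s (+-mono-≤ m≤k₁ m≤k₂)) (walk-length< D acyclic longest (w₁ ◅◅ w₂)))
        where
        m≤k₂ : m ≤ k₂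
        m≤k₂ = ⊕-cancel-≤ (c s ⊕ 1)
                 (trans (⊕-inverseʳ (c s)) (trans (colour-walk w₂) (cong (_⊕ k₂) cx≡a))) (n<1+n m)

lemma3 : (G : Graph) → Connected G → (χ : ℕ) → ChromaticNumber G χ →
    (c : Coloring G χ) → Nice G χ c →
    (h : ℕ) → IsHeight (Arc G χ c) h → (χ + χ) ∸ 1 ≤ h
lemma3 G _ zero _ c (_ , _ , s , _) _ _ with c s
... | ()
lemma3 G _ (suc m) (_ , minimal) c (proper , acyclic , s , _ , unique) h (_ , longest) =
  decidable-stable (m + suc m ≤? h) λ short →
    -- The goal is decidable, so ReachesColour may be decided classically at every vertex.
    sequence (RawMonad.rawApplicative ¬¬-Monad) (λ v → ¬¬-excluded-middle) λ decide →
      let open Recolour G c proper (c s ⊕ 1)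
          shifted-avoids v rv eq = shifted-onto-successor⇒long G c acyclic unique longest v rv eq short
          c′ , proper′ = omitColour G (λ v → recolour (decide v)) (c s ⊕ 1)
                           (λ {u} {v} adj → recolour-proper (decide u) (decide v) adj)
                           (λ v → recolour-avoids shifted-avoids (decide v))
      in 1+n≰n (minimal m c′ proper′)
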